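{- Let $\varGamma$ be a planar lattice equipped with a positive definite, integer-valued, primitive symmetric bilinear form $(\cdot,\cdot)$, and let $d$ be its discriminant. Let $w$ be a primitive vector in $\varGamma$, let $g^*(w)$ denote its coefficient in the dual lattice $\varGamma^*$, and let $\varGamma_w$ be the sublattice spanned by $w$ and the primitive vector $z\in\varGamma$ orthogonal to $w$. Then $g^*(w)$ is a divisor of $d$, and \[ [\varGamma : \varGamma_w ] \, = \, \frac{(w,w)}{g^*(w)} \, . \]
   Context: Primitivity of the form means it is not a proper integral multiple of another form, i.e. $\gcd(a,b,c)=1$ for the Gram matrix $\left(\begin{smallmatrix} a & b \\ b & c\end{smallmatrix}\right)$ with respect to any basis of $\varGamma$; the discriminant $d=ac-b^2$ is the determinant of any Gram matrix of $\varGamma$. The dual lattice is $\varGamma^* = \{u \in \mathbb{Q}\varGamma \mid (v,u)\in\mathbb{Z} \text{ for all } v\in\varGamma\}$, which contains $\varGamma$. For a lattice $L$ and a vector $v\in\mathbb{Q} L$, the coefficient $g_L(v)$ is the unique positive rational number $g$ such that $v=g v_0$ with $v_0$ primitive in $L$ (equivalently, the gcd in $\mathbb{Q}$ of the coordinates of $v$ with respect to a $\mathbb{Z}$-basis of $L$); $g^* := g_{\varGamma^*}$. A vector is primitive in $L$ iff its coefficient is $1$. The primitive vector $z\perp w$ in $\varGamma$ is unique up to sign, so $\varGamma_w=\mathbb{Z}w\oplus\mathbb{Z}z$ is well defined (a "basic rectangular or square" sublattice). -}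

module Defs where

open import Data.Nat using (ℕ; _≥_)
open import Data.Integer using (ℤ; +_; _+_; _-_; _*_; _<_; 0ℤ; 1ℤ)
open import Data.Integer.Divisibility using (_∣_)
open import Data.Integer.GCD using (gcd)
open import Data.Fin using (Fin)
open import Data.Product using (_×_; _,_; ∃; ∃-syntax; Σ)
open import Relation.Binary.PropositionalEquality using (_≡_; _≢_)
open import Relation.Nullary using (¬_)

-- The planar lattice Γ, after fixing a ℤ-basis, is ℤ²; a vector is its
-- coordinate pair.  The form is given by its Gram matrix (a b ; b c).
V : Set
V = ℤ × ℤ

_⊕_ : V → V → V
(x₁ , x₂) ⊕ (y₁ , y₂) = (x₁ + y₁ , x₂ + y₂)

_⊖_ : V → V → V
(x₁ , x₂) ⊖ (y₁ , y₂) = (x₁ - y₁ , x₂ - y₂)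

_·_ : ℤ → V → V
s · (x₁ , x₂) = (s * x₁ , s * x₂)

record Form : Set where
  constructor form
  field
    a b c : ℤ

⟪_⟫ : Form → V → V → ℤ
⟪ form a b c ⟫ (x₁ , x₂) (y₁ , y₂) =
  a * x₁ * y₁ + b * (x₁ * y₂ + x₂ * y₁) + c * x₂ * y₂

disc : Form → ℤ
disc (form a b c) = a * c - b * b

PosDef : Form → Set
PosDef F = ∀ (v : V) → v ≢ (0ℤ , 0ℤ) → 0ℤ < ⟪ F ⟫ v v

PrimitiveForm : Form → Set
PrimitiveForm (form a b c) = gcd (gcd a b) c ≡ 1ℤ

PrimitiveVec : V → Set
PrimitiveVec (x₁ , x₂) = gcd x₁ x₂ ≡ 1ℤ

-- For w ∈ Γ and a positive integer g:  w/g ∈ Γ*, i.e. (v , w/g) ∈ ℤ for all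
-- v ∈ Γ, i.e. g divides (v , w) for all v ∈ Γ.
DivInDual : Form → V → ℕ → Set
DivInDual F w g = ∀ (v : V) → (+ g) ∣ ⟪ F ⟫ v w

-- g*(w) = g : w = g·v₀ with v₀ = w/g ∈ Γ* primitive in Γ*, i.e. v₀ is not
-- k·u with u ∈ Γ* and k ≥ 2 an integer (equivalently w/(g k) ∉ Γ*).
-- (Since w ∈ Γ ⊆ Γ*, the coefficient g*(w) is automatically a positive integer.)
IsDualCoeff : Form → V → ℕ → Set
IsDualCoeff F w g =
  g ≥ 1 × DivInDual F w g × (∀ (k : ℕ) → k ≥ 2 → ¬ DivInDual F w (g Data.Nat.* k))

InSpan : V → V → V → Set
InSpan w z v = ∃[ s ] ∃[ t ] v ≡ (s · w) ⊕ (t · z)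

IsIndex : V → V → ℕ → Set
IsIndex w z n = Σ (Fin n → V) λ r →
  (∀ (v : V) → ∃[ i ] InSpan w z (v ⊖ r i)) ×
  (∀ (i j : Fin n) → InSpan w z (r i ⊖ r j) → i ≡ j)

-- The functional (·, w) is v ↦ v ∙ G w, where G is the Gram matrix, so w/h lies in Γ* exactly
-- when h divides both coordinates of G w, and g*(w) is their gcd.  Since z ⊥ w, one has
-- det(w, z) · G w = (w, w) · (z₂, −z₁); taking gcds of coordinates, z being primitive, gives
-- |det(w, z)| · g*(w) = (w, w).  As w is primitive it has a complement u with det(w, u) = 1;
-- then v ∈ ℤw ⊕ ℤz iff det(w, z) divides det(w, v), so the multiples i · u with
-- 0 ≤ i < |det(w, z)| represent the cosets and [Γ : Γ_w] = |det(w, z)|.  Finally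
-- d · w = adj(G) · (G w), so g*(w) divides d w₁ and d w₂, hence d.

module Submission where

open import Defs
open import Data.Nat using (ℕ)
open import Data.Integer using (ℤ; +_; _*_; 0ℤ)
open import Data.Integer.Divisibility using (_∣_)
open import Data.Product using (_×_; Σ)
open import Relation.Binary.PropositionalEquality using (_≡_)

import Data.Nat as ℕ
import Data.Nat.Properties as ℕ
open import Data.Nat.Divisibility using (divides; ∣-refl; ∣-reflexive; ∣-trans; _∣0; ∣⇒≤)
  renaming (_∣_ to _∣ℕ_)
open import Data.Nat.GCD using (gcd[m,n]∣m; gcd[m,n]∣n; gcd-greatest; c*gcd[m,n]≡gcd[cm,cn]; module Bézout)
  renaming (gcd to gcdℕ)
open import Data.Nat.Coprimality using (gcd≡1⇒coprime; coprime-Bézout)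
open import Data.Integer
  using (_+_; _-_; -_; _<_; ∣_∣; 1ℤ; -1ℤ; +[1+_]; -[1+_]; NonZero; >-nonZero)
open import Data.Integer.Properties
  using ( +-injective; pos-+; pos-*; abs-*; ∣-i∣≡∣i∣; +∣i∣≡i⊎+∣i∣≡-i; -1*i≡-i
        ; *-identityˡ; *-identityʳ; *-assoc; +-comm; +-identityʳ; i-j≡0⇒i≡j
        ; m-n≡m⊖n; ∣m⊝n∣≤m⊔n; 0≤i⇒+∣i∣≡i; <⇒≤)
import Data.Integer.Divisibility.Signed as Signed
open import Data.Integer.GCD using (gcd-comm; gcd[0,0]≡0)
open import Data.Integer.DivMod using (_%_; _/_; a≡a%n+[a/n]*n; n%d<d)
open import Data.Integer.Tactic.RingSolver using (solve-∀)
open import Data.Fin using (Fin; toℕ; fromℕ<)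
open import Data.Fin.Properties using (toℕ-fromℕ<; toℕ<n; toℕ-injective; injective⇒≤)
open import Data.Product using (_,_; proj₁; proj₂; ∃-syntax; ∃₂)
open import Data.Sum using (inj₁; inj₂)
open import Data.Empty using (⊥-elim)
open import Relation.Nullary using (¬_)
open import Relation.Binary.PropositionalEquality
  using (refl; sym; trans; cong; cong₂; subst; _≢_; module ≡-Reasoning)

-- Bézout's identity over ℤ

abs-as-multiple : ∀ i → ∃[ ε ] + ∣ i ∣ ≡ ε * i
abs-as-multiple i with +∣i∣≡i⊎+∣i∣≡-i i
... | inj₁ ∣i∣≡i  = 1ℤ , trans ∣i∣≡i (sym (*-identityˡ i))
... | inj₂ ∣i∣≡-i = -1ℤ , trans ∣i∣≡-i (sym (-1*i≡-i i))

difference≡1 : ∀ x y m n → 1 ℕ.+ y ℕ.* n ≡ x ℕ.* m → + x * + m + - + y * + n ≡ 1ℤ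
difference≡1 x y m n eq = begin
  + x * + m + - + y * + n            ≡⟨ cong (λ k → k + - + y * + n) xm≡1+yn ⟩
  1ℤ + + y * + n + - + y * + n       ≡⟨ cancel (+ y) (+ n) ⟩
  1ℤ                                 ∎
  where
  open ≡-Reasoning
  xm≡1+yn : + x * + m ≡ 1ℤ + + y * + n
  xm≡1+yn = begin
    + x * + m            ≡⟨ pos-* x m ⟨
    + (x ℕ.* m)          ≡⟨ cong +_ eq ⟨
    + (1 ℕ.+ y ℕ.* n)    ≡⟨ pos-+ 1 (y ℕ.* n) ⟩
    1ℤ + + (y ℕ.* n)     ≡⟨ cong (λ k → 1ℤ + k) (pos-* y n) ⟩
    1ℤ + + y * + n       ∎
  cancel : ∀ a b → 1ℤ + a * b + - a * b ≡ 1ℤ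
  cancel = solve-∀

identity⇒combination : ∀ {m n} → Bézout.Identity 1 m n → ∃₂ λ s t → s * + m + t * + n ≡ 1ℤ
identity⇒combination (Bézout.+- x y eq) = + x , - + y , difference≡1 x y _ _ eq
identity⇒combination (Bézout.-+ x y eq) = - + x , + y , trans (+-comm (- + x * + _) (+ y * + _)) (difference≡1 y x _ _ eq)

primitive⇒bezout : ∀ {x y} → PrimitiveVec (x , y) → ∃₂ λ s t → s * x + t * y ≡ 1ℤ
primitive⇒bezout {x} {y} gcd≡1
  with identity⇒combination (coprime-Bézout (gcd≡1⇒coprime (+-injective gcd≡1)))
     | abs-as-multiple x | abs-as-multiple y
... | s , t , eq | εx , ∣x∣≡εx*x | εy , ∣y∣≡εy*y = s * εx , t * εy , (begin
  s * εx * x + t * εy * y       ≡⟨ cong₂ _+_ (*-assoc s εx x) (*-assoc t εy y) ⟩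
  s * (εx * x) + t * (εy * y)   ≡⟨ cong₂ (λ p q → s * p + t * q) ∣x∣≡εx*x ∣y∣≡εy*y ⟨
  s * + ∣ x ∣ + t * + ∣ y ∣     ≡⟨ eq ⟩
  1ℤ                            ∎)
  where open ≡-Reasoning

primitive⇒≢0 : ∀ {w} → PrimitiveVec w → w ≢ (0ℤ , 0ℤ)
primitive⇒≢0 gcd≡1 refl with trans (sym gcd[0,0]≡0) gcd≡1
... | ()

-- Determinants and the index of ℤw ⊕ ℤz

det : V → V → ℤ
det (x₁ , x₂) (y₁ , y₂) = x₁ * y₂ - x₂ * y₁

primitive⇒complement : ∀ {w} → PrimitiveVec w → ∃[ u ] det w u ≡ 1ℤ
primitive⇒complement {w₁ , w₂} prim with primitive⇒bezout prim
... | s , t , eq = (- t , s) , trans (expand s t w₁ w₂) eq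
  where
  expand : ∀ s t w₁ w₂ → w₁ * s - w₂ * - t ≡ s * w₁ + t * w₂
  expand = solve-∀

-- The ring solver does not unfold det, _·_ or ⟪_⟫, so each vector identity below is reduced to
-- ring identities on the coordinates, stated in expanded form.
det-⊖ : ∀ w v v′ → det w (v ⊖ v′) ≡ det w v - det w v′
det-⊖ (w₁ , w₂) (v₁ , v₂) (v₁′ , v₂′) = identity w₁ w₂ v₁ v₂ v₁′ v₂′
  where
  identity : ∀ w₁ w₂ v₁ v₂ v₁′ v₂′ →
    w₁ * (v₂ - v₂′) - w₂ * (v₁ - v₁′) ≡ (w₁ * v₂ - w₂ * v₁) - (w₁ * v₂′ - w₂ * v₁′)
  identity = solve-∀

det-· : ∀ w i v → det w (i · v) ≡ i * det w v
det-· (w₁ , w₂) i (v₁ , v₂) = identity w₁ w₂ i v₁ v₂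
  where
  identity : ∀ w₁ w₂ i v₁ v₂ → w₁ * (i * v₂) - w₂ * (i * v₁) ≡ i * (w₁ * v₂ - w₂ * v₁)
  identity = solve-∀

det-span : ∀ w z s t → det w ((s · w) ⊕ (t · z)) ≡ t * det w z
det-span (w₁ , w₂) (z₁ , z₂) s t = identity w₁ w₂ z₁ z₂ s t
  where
  identity : ∀ w₁ w₂ z₁ z₂ s t →
    w₁ * (s * w₂ + t * z₂) - w₂ * (s * w₁ + t * z₁) ≡ t * (w₁ * z₂ - w₂ * z₁)
  identity = solve-∀

det-cramer : ∀ w u v → det w u · v ≡ (det v u · w) ⊕ (det w v · u)
det-cramer (w₁ , w₂) (u₁ , u₂) (v₁ , v₂) =
  cong₂ _,_ (first w₁ w₂ u₁ u₂ v₁ v₂) (second w₁ w₂ u₁ u₂ v₁ v₂)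
  where
  first : ∀ w₁ w₂ u₁ u₂ v₁ v₂ →
    (w₁ * u₂ - w₂ * u₁) * v₁ ≡ (v₁ * u₂ - v₂ * u₁) * w₁ + (w₁ * v₂ - w₂ * v₁) * u₁
  first = solve-∀
  second : ∀ w₁ w₂ u₁ u₂ v₁ v₂ →
    (w₁ * u₂ - w₂ * u₁) * v₂ ≡ (v₁ * u₂ - v₂ * u₁) * w₂ + (w₁ * v₂ - w₂ * v₁) * u₂
  second = solve-∀

·-identityˡ : ∀ v → 1ℤ · v ≡ v
·-identityˡ (v₁ , v₂) = cong₂ _,_ (*-identityˡ v₁) (*-identityˡ v₂)

cramer : ∀ {w u} → det w u ≡ 1ℤ → ∀ v → v ≡ (det v u · w) ⊕ (det w v · u)
cramer {w} {u} wu≡1 v = begin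
  v            ≡⟨ ·-identityˡ v ⟨
  1ℤ · v       ≡⟨ cong (_· v) wu≡1 ⟨
  det w u · v  ≡⟨ det-cramer w u v ⟩
  (det v u · w) ⊕ (det w v · u) ∎
  where open ≡-Reasoning

span-regroup : ∀ x q D α w u → (x · w) ⊕ ((q * D) · u) ≡ ((x - q * α) · w) ⊕ (q · ((α · w) ⊕ (D · u)))
span-regroup x q D α (w₁ , w₂) (u₁ , u₂) =
  cong₂ _,_ (identity x q D α w₁ u₁) (identity x q D α w₂ u₂)
  where
  identity : ∀ x q D α wᵢ uᵢ → x * wᵢ + q * D * uᵢ ≡ (x - q * α) * wᵢ + q * (α * wᵢ + D * uᵢ)
  identity = solve-∀

InSpan⇒det-multiple : ∀ {w z v} → InSpan w z v → ∃[ t ] det w v ≡ t * det w z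
InSpan⇒det-multiple {w} {z} (s , t , refl) = t , det-span w z s t

det-multiple⇒InSpan : ∀ {w u z v} q → det w u ≡ 1ℤ → det w v ≡ q * det w z → InSpan w z v
det-multiple⇒InSpan {w} {u} {z} {v} q wu≡1 wv≡q*wz = det v u - q * det z u , q , (begin
  v                                                  ≡⟨ cramer {w} {u} wu≡1 v ⟩
  (det v u · w) ⊕ (det w v · u)                      ≡⟨ cong (λ k → (det v u · w) ⊕ (k · u)) wv≡q*wz ⟩
  (det v u · w) ⊕ ((q * det w z) · u)                ≡⟨ span-regroup (det v u) q (det w z) (det z u) w u ⟩
  ((det v u - q * det z u) · w) ⊕ (q · ((det z u · w) ⊕ (det w z · u)))
                                                     ≡⟨ cong (λ k → ((det v u - q * det z u) · w) ⊕ (q · k)) (cramer {w} {u} wu≡1 z) ⟨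
  ((det v u - q * det z u) · w) ⊕ (q · z)            ∎)
  where open ≡-Reasoning

difference≢nonzero-multiple : ∀ {m n} D t .{{_ : NonZero t}} →
  m ℕ.< ∣ D ∣ → n ℕ.< ∣ D ∣ → + m - + n ≢ t * D
difference≢nonzero-multiple {m} {n} D t m<D n<D eq = ℕ.<-irrefl refl (begin-strict
  ∣ D ∣              ≤⟨ ℕ.m≤n*m ∣ D ∣ ∣ t ∣ ⟩
  ∣ t ∣ ℕ.* ∣ D ∣    ≡⟨ abs-* t D ⟨
  ∣ t * D ∣          ≡⟨ cong ∣_∣ eq ⟨
  ∣ + m - + n ∣      ≤⟨ subst (ℕ._≤ m ℕ.⊔ n) (cong ∣_∣ (sym (m-n≡m⊖n m n))) (∣m⊝n∣≤m⊔n m n) ⟩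
  m ℕ.⊔ n            <⟨ ℕ.⊔-lub m<D n<D ⟩
  ∣ D ∣              ∎)
  where open ℕ.≤-Reasoning

difference-multiple⇒≡ : ∀ {m n} D t → m ℕ.< ∣ D ∣ → n ℕ.< ∣ D ∣ → + m - + n ≡ t * D → m ≡ n
difference-multiple⇒≡ D (+ 0)        _   _   eq = +-injective (i-j≡0⇒i≡j _ _ eq)
difference-multiple⇒≡ D t@(+[1+ _ ]) m<D n<D eq = ⊥-elim (difference≢nonzero-multiple D t m<D n<D eq)
difference-multiple⇒≡ D t@(-[1+ _ ]) m<D n<D eq = ⊥-elim (difference≢nonzero-multiple D t m<D n<D eq)

index≡∣det∣ : ∀ w u z → det w u ≡ 1ℤ → .{{_ : NonZero (det w z)}} → IsIndex w z ∣ det w z ∣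
index≡∣det∣ w u z wu≡1 = r , complete , irredundant
  where
  open ≡-Reasoning
  D : ℤ
  D = det w z
  r : Fin ∣ D ∣ → V
  r i = (+ toℕ i) · u
  det-r : ∀ i → det w (r i) ≡ + toℕ i
  det-r i = begin
    det w ((+ toℕ i) · u) ≡⟨ det-· w (+ toℕ i) u ⟩
    + toℕ i * det w u     ≡⟨ cong (+ toℕ i *_) wu≡1 ⟩
    + toℕ i * 1ℤ          ≡⟨ *-identityʳ (+ toℕ i) ⟩
    + toℕ i               ∎
  det-r-⊖ : ∀ v i → det w (v ⊖ r i) ≡ det w v - + toℕ i
  det-r-⊖ v i = trans (det-⊖ w v (r i)) (cong (λ k → det w v - k) (det-r i))
  complete : ∀ v → ∃[ i ] InSpan w z (v ⊖ r i)
  complete v = fromℕ< ρ<∣D∣ , det-multiple⇒InSpan (det w v / D) wu≡1 (begin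
    det w (v ⊖ r (fromℕ< ρ<∣D∣))             ≡⟨ det-r-⊖ v (fromℕ< ρ<∣D∣) ⟩
    det w v - + toℕ (fromℕ< ρ<∣D∣)           ≡⟨ cong (λ k → det w v - + k) (toℕ-fromℕ< ρ<∣D∣) ⟩
    det w v - + (det w v % D)                ≡⟨ cong (_- + (det w v % D)) (a≡a%n+[a/n]*n (det w v) D) ⟩
    + (det w v % D) + (det w v / D) * D - + (det w v % D) ≡⟨ cancel (+ (det w v % D)) _ ⟩
    (det w v / D) * D                        ∎)
    where
    ρ<∣D∣ : det w v % D ℕ.< ∣ D ∣
    ρ<∣D∣ = n%d<d (det w v) D
    cancel : ∀ a b → a + b - a ≡ b
    cancel = solve-∀
  irredundant : ∀ i j → InSpan w z (r i ⊖ r j) → i ≡ j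
  irredundant i j span with InSpan⇒det-multiple span
  ... | t , eq = toℕ-injective (difference-multiple⇒≡ D t (toℕ<n i) (toℕ<n j) (begin
    + toℕ i - + toℕ j         ≡⟨ cong (_- + toℕ j) (det-r i) ⟨
    det w (r i) - + toℕ j     ≡⟨ det-r-⊖ (r i) j ⟨
    det w (r i ⊖ r j)         ≡⟨ eq ⟩
    t * D                     ∎))

⊖-⊖-cancel : ∀ a b c → (a ⊖ c) ⊖ (b ⊖ c) ≡ a ⊖ b
⊖-⊖-cancel (a₁ , a₂) (b₁ , b₂) (c₁ , c₂) = cong₂ _,_ (identity a₁ b₁ c₁) (identity a₂ b₂ c₂)
  where
  identity : ∀ a b c → (a - c) - (b - c) ≡ a - b
  identity = solve-∀

span-⊖ : ∀ w z s t s′ t′ → ((s · w) ⊕ (t · z)) ⊖ ((s′ · w) ⊕ (t′ · z)) ≡ ((s - s′) · w) ⊕ ((t - t′) · z)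
span-⊖ (w₁ , w₂) (z₁ , z₂) s t s′ t′ =
  cong₂ _,_ (identity s t s′ t′ w₁ z₁) (identity s t s′ t′ w₂ z₂)
  where
  identity : ∀ s t s′ t′ w z → (s * w + t * z) - (s′ * w + t′ * z) ≡ (s - s′) * w + (t - t′) * z
  identity = solve-∀

InSpan-⊖ : ∀ {w z} a b c → InSpan w z (a ⊖ c) → InSpan w z (b ⊖ c) → InSpan w z (a ⊖ b)
InSpan-⊖ {w} {z} a b c (s , t , a-c≡) (s′ , t′ , b-c≡) = s - s′ , t - t′ , (begin
  a ⊖ b                                       ≡⟨ ⊖-⊖-cancel a b c ⟨
  (a ⊖ c) ⊖ (b ⊖ c)                           ≡⟨ cong₂ _⊖_ a-c≡ b-c≡ ⟩
  ((s · w) ⊕ (t · z)) ⊖ ((s′ · w) ⊕ (t′ · z)) ≡⟨ span-⊖ w z s t s′ t′ ⟩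
  ((s - s′) · w) ⊕ ((t - t′) · z)             ∎)
  where open ≡-Reasoning

index-≤ : ∀ {w z m n} → IsIndex w z m → IsIndex w z n → m ℕ.≤ n
index-≤ {w} {z} (r , _ , r-irredundant) (r′ , r′-complete , _) = injective⇒≤ class-injective
  where
  class : Fin _ → Fin _
  class i = proj₁ (r′-complete (r i))
  class-injective : ∀ {i j} → class i ≡ class j → i ≡ j
  class-injective {i} {j} same = r-irredundant i j (InSpan-⊖ (r i) (r j) (r′ (class i))
    (proj₂ (r′-complete (r i)))
    (subst (λ k → InSpan w z (r j ⊖ r′ k)) (sym same) (proj₂ (r′-complete (r j)))))

index-unique : ∀ {w z m n} → IsIndex w z m → IsIndex w z n → m ≡ n
index-unique m-index n-index = ℕ.≤-antisym (index-≤ m-index n-index) (index-≤ n-index m-index)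

-- The dual coefficient

gcd-abs-* : ∀ k x y → gcdℕ (∣ k * x ∣) (∣ k * y ∣) ≡ ∣ k ∣ ℕ.* gcdℕ (∣ x ∣) (∣ y ∣)
gcd-abs-* k x y = trans (cong₂ gcdℕ (abs-* k x) (abs-* k y))
                        (sym (c*gcd[m,n]≡gcd[cm,cn] (∣ k ∣) (∣ x ∣) (∣ y ∣)))

primitive⇒gcd-abs-* : ∀ {x y} → PrimitiveVec (x , y) → ∀ k → gcdℕ (∣ k * x ∣) (∣ k * y ∣) ≡ ∣ k ∣
primitive⇒gcd-abs-* {x} {y} prim k = begin
  gcdℕ (∣ k * x ∣) (∣ k * y ∣)      ≡⟨ gcd-abs-* k x y ⟩
  ∣ k ∣ ℕ.* gcdℕ (∣ x ∣) (∣ y ∣)    ≡⟨ cong (∣ k ∣ ℕ.*_) (+-injective prim) ⟩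
  ∣ k ∣ ℕ.* 1                       ≡⟨ ℕ.*-identityʳ ∣ k ∣ ⟩
  ∣ k ∣                             ∎
  where open ≡-Reasoning

_∙_ : V → V → ℤ
(x₁ , x₂) ∙ (y₁ , y₂) = x₁ * y₁ + x₂ * y₂

∙-e₁ : ∀ x → (1ℤ , 0ℤ) ∙ x ≡ proj₁ x
∙-e₁ (x₁ , x₂) = identity x₁ x₂
  where
  identity : ∀ x₁ x₂ → 1ℤ * x₁ + 0ℤ * x₂ ≡ x₁
  identity = solve-∀

∙-e₂ : ∀ x → (0ℤ , 1ℤ) ∙ x ≡ proj₂ x
∙-e₂ (x₁ , x₂) = identity x₁ x₂
  where
  identity : ∀ x₁ x₂ → 0ℤ * x₁ + 1ℤ * x₂ ≡ x₂
  identity = solve-∀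

gram : Form → V → V
gram (form a b c) (w₁ , w₂) = a * w₁ + b * w₂ , b * w₁ + c * w₂

⟪⟫≡∙gram : ∀ F v w → ⟪ F ⟫ v w ≡ v ∙ gram F w
⟪⟫≡∙gram (form a b c) (v₁ , v₂) (w₁ , w₂) = identity a b c v₁ v₂ w₁ w₂
  where
  identity : ∀ a b c v₁ v₂ w₁ w₂ →
    a * v₁ * w₁ + b * (v₁ * w₂ + v₂ * w₁) + c * v₂ * w₂ ≡ v₁ * (a * w₁ + b * w₂) + v₂ * (b * w₁ + c * w₂)
  identity = solve-∀

dualGcd : Form → V → ℕ
dualGcd F w = gcdℕ (∣ proj₁ (gram F w) ∣) (∣ proj₂ (gram F w) ∣)

dualGcd∣∙gram : ∀ F w v → + dualGcd F w ∣ v ∙ gram F w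
dualGcd∣∙gram F w (v₁ , v₂) = Signed.∣⇒∣ᵤ (Signed.∣m∣n⇒∣m+n
  (Signed.∣n⇒∣m*n v₁ (Signed.∣ᵤ⇒∣ {+ dualGcd F w} (gcd[m,n]∣m (∣ G₁ ∣) (∣ G₂ ∣))))
  (Signed.∣n⇒∣m*n v₂ (Signed.∣ᵤ⇒∣ {+ dualGcd F w} (gcd[m,n]∣n (∣ G₁ ∣) (∣ G₂ ∣)))))
  where
  G₁ G₂ : ℤ
  G₁ = proj₁ (gram F w)
  G₂ = proj₂ (gram F w)

∣dualGcd⇒DivInDual : ∀ F w {h} → h ∣ℕ dualGcd F w → DivInDual F w h
∣dualGcd⇒DivInDual F w h∣g v =
  ∣-trans h∣g (subst (+ dualGcd F w ∣_) (sym (⟪⟫≡∙gram F v w)) (dualGcd∣∙gram F w v))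

DivInDual⇒∣dualGcd : ∀ F w {h} → DivInDual F w h → h ∣ℕ dualGcd F w
DivInDual⇒∣dualGcd F w {h} h∣⟪·,w⟫ = gcd-greatest
  (subst (+ h ∣_) (trans (⟪⟫≡∙gram F (1ℤ , 0ℤ) w) (∙-e₁ (gram F w))) (h∣⟪·,w⟫ (1ℤ , 0ℤ)))
  (subst (+ h ∣_) (trans (⟪⟫≡∙gram F (0ℤ , 1ℤ) w) (∙-e₂ (gram F w))) (h∣⟪·,w⟫ (0ℤ , 1ℤ)))

isDualCoeff-dualGcd : ∀ F w .{{_ : ℕ.NonZero (dualGcd F w)}} → IsDualCoeff F w (dualGcd F w)
isDualCoeff-dualGcd F w = ℕ.>-nonZero⁻¹ g , ∣dualGcd⇒DivInDual F w ∣-refl , not-divisible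
  where
  g : ℕ
  g = dualGcd F w
  not-divisible : ∀ k → k ℕ.≥ 2 → ¬ DivInDual F w (g ℕ.* k)
  not-divisible k k≥2 g*k∣⟪·,w⟫ =
    ℕ.<-irrefl refl (ℕ.<-≤-trans (ℕ.m<m*n g k k≥2) (∣⇒≤ (DivInDual⇒∣dualGcd F w g*k∣⟪·,w⟫)))

isDualCoeff⇒≡dualGcd : ∀ F w {g} → IsDualCoeff F w g → g ≡ dualGcd F w
isDualCoeff⇒≡dualGcd F w {g} (_ , g∣⟪·,w⟫ , maximal) with DivInDual⇒∣dualGcd F w g∣⟪·,w⟫
... | divides 1 eq = sym (trans eq (ℕ.*-identityˡ g))
... | divides 0 eq = ⊥-elim (maximal 2 ℕ.≤-refl
        (∣dualGcd⇒DivInDual F w (subst ((g ℕ.* 2) ∣ℕ_) (sym eq) ((g ℕ.* 2) ∣0))))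
... | divides q@(ℕ.suc (ℕ.suc _)) eq = ⊥-elim (maximal q (ℕ.s≤s (ℕ.s≤s ℕ.z≤n))
        (∣dualGcd⇒DivInDual F w (∣-reflexive (sym (trans eq (ℕ.*-comm q g))))))

disc-adjugate : ∀ a b c w → let F = form a b c in
  disc F · w ≡ ((c , - b) ∙ gram F w , (- b , a) ∙ gram F w)
disc-adjugate a b c (w₁ , w₂) = cong₂ _,_ (first a b c w₁ w₂) (second a b c w₁ w₂)
  where
  first : ∀ a b c w₁ w₂ → (a * c - b * b) * w₁ ≡ c * (a * w₁ + b * w₂) + - b * (b * w₁ + c * w₂)
  first = solve-∀
  second : ∀ a b c w₁ w₂ → (a * c - b * b) * w₂ ≡ - b * (a * w₁ + b * w₂) + a * (b * w₁ + c * w₂)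
  second = solve-∀

dualGcd∣disc : ∀ F {w} → PrimitiveVec w → + dualGcd F w ∣ disc F
dualGcd∣disc F@(form a b c) {w@(w₁ , w₂)} prim =
  subst (dualGcd F w ∣ℕ_) (primitive⇒gcd-abs-* prim (disc F)) (gcd-greatest
    (subst (+ dualGcd F w ∣_) (sym (cong proj₁ (disc-adjugate a b c w))) (dualGcd∣∙gram F w (c , - b)))
    (subst (+ dualGcd F w ∣_) (sym (cong proj₂ (disc-adjugate a b c w))) (dualGcd∣∙gram F w (- b , a))))

perp : V → V
perp (x₁ , x₂) = x₂ , - x₁

perp-primitive : ∀ {z} → PrimitiveVec z → PrimitiveVec (perp z)
perp-primitive {z₁ , z₂} prim =
  trans (cong (λ n → + gcdℕ (∣ z₂ ∣) n) (∣-i∣≡∣i∣ z₁)) (trans (gcd-comm z₂ z₁) prim)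

det·gram : ∀ F w z → det w z · gram F w ≡ (⟪ F ⟫ w w · perp z) ⊖ (⟪ F ⟫ w z · perp w)
det·gram (form a b c) (w₁ , w₂) (z₁ , z₂) =
  cong₂ _,_ (first a b c w₁ w₂ z₁ z₂) (second a b c w₁ w₂ z₁ z₂)
  where
  first : ∀ a b c w₁ w₂ z₁ z₂ →
    (w₁ * z₂ - w₂ * z₁) * (a * w₁ + b * w₂)
      ≡ (a * w₁ * w₁ + b * (w₁ * w₂ + w₂ * w₁) + c * w₂ * w₂) * z₂
        - (a * w₁ * z₁ + b * (w₁ * z₂ + w₂ * z₁) + c * w₂ * z₂) * w₂
  first = solve-∀
  second : ∀ a b c w₁ w₂ z₁ z₂ →
    (w₁ * z₂ - w₂ * z₁) * (b * w₁ + c * w₂)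
      ≡ (a * w₁ * w₁ + b * (w₁ * w₂ + w₂ * w₁) + c * w₂ * w₂) * - z₁
        - (a * w₁ * z₁ + b * (w₁ * z₂ + w₂ * z₁) + c * w₂ * z₂) * - w₁
  second = solve-∀

⊖-0· : ∀ v u → v ⊖ (0ℤ · u) ≡ v
⊖-0· (v₁ , v₂) _ = cong₂ _,_ (+-identityʳ v₁) (+-identityʳ v₂)

∣det∣*dualGcd≡∣⟪w,w⟫∣ : ∀ F {w z} → PrimitiveVec z → ⟪ F ⟫ w z ≡ 0ℤ →
  ∣ det w z ∣ ℕ.* dualGcd F w ≡ ∣ ⟪ F ⟫ w w ∣
∣det∣*dualGcd≡∣⟪w,w⟫∣ F {w} {z} prim w⊥z = begin
  ∣ D ∣ ℕ.* dualGcd F w                          ≡⟨ gcd-abs-* D (proj₁ (gram F w)) (proj₂ (gram F w)) ⟨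
  gcdℕ (∣ proj₁ (D · gram F w) ∣) (∣ proj₂ (D · gram F w) ∣)
                                                 ≡⟨ cong₂ (λ p q → gcdℕ (∣ p ∣) (∣ q ∣)) (cong proj₁ D·gram≡) (cong proj₂ D·gram≡) ⟩
  gcdℕ (∣ proj₁ (Q · perp z) ∣) (∣ proj₂ (Q · perp z) ∣)
                                                 ≡⟨ primitive⇒gcd-abs-* (perp-primitive {z} prim) Q ⟩
  ∣ Q ∣                                          ∎
  where
  open ≡-Reasoning
  D Q : ℤ
  D = det w z
  Q = ⟪ F ⟫ w w
  D·gram≡ : D · gram F w ≡ Q · perp z
  D·gram≡ = begin
    D · gram F w                               ≡⟨ det·gram F w z ⟩
    (Q · perp z) ⊖ (⟪ F ⟫ w z · perp w)        ≡⟨ cong (λ k → (Q · perp z) ⊖ (k · perp w)) w⊥z ⟩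
    (Q · perp z) ⊖ (0ℤ · perp w)               ≡⟨ ⊖-0· (Q · perp z) (perp w) ⟩
    Q · perp z                                 ∎

propositionC1 : (F : Form) → PosDef F → PrimitiveForm F →
    (w z : V) → PrimitiveVec w → PrimitiveVec z → ⟪ F ⟫ w z ≡ 0ℤ →
    Σ ℕ (IsDualCoeff F w) × Σ ℕ (IsIndex w z) ×
    ((g : ℕ) → IsDualCoeff F w g →
      ((+ g) ∣ disc F) × ((n : ℕ) → IsIndex w z n → (+ n) * (+ g) ≡ ⟪ F ⟫ w w))
propositionC1 F posDef _ w z w-primitive z-primitive w⊥z =
  (dualGcd F w , isDualCoeff-dualGcd F w) , (∣ det w z ∣ , index) ,
  λ g g-coeff → subst (λ h → + h ∣ disc F) (sym (isDualCoeff⇒≡dualGcd F w g-coeff)) (dualGcd∣disc F w-primitive) ,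
  λ n n-index → begin
    + n * + g                           ≡⟨ cong₂ (λ n g → + n * + g) (index-unique n-index index) (isDualCoeff⇒≡dualGcd F w g-coeff) ⟩
    + ∣ det w z ∣ * + dualGcd F w       ≡⟨ pos-* ∣ det w z ∣ (dualGcd F w) ⟨
    + (∣ det w z ∣ ℕ.* dualGcd F w)     ≡⟨ cong +_ ∣D∣*g≡∣Q∣ ⟩
    + ∣ ⟪ F ⟫ w w ∣                     ≡⟨ 0≤i⇒+∣i∣≡i (<⇒≤ Q>0) ⟩
    ⟪ F ⟫ w w                           ∎
  where
  open ≡-Reasoning
  Q>0 : 0ℤ < ⟪ F ⟫ w w
  Q>0 = posDef w (primitive⇒≢0 w-primitive)
  ∣D∣*g≡∣Q∣ : ∣ det w z ∣ ℕ.* dualGcd F w ≡ ∣ ⟪ F ⟫ w w ∣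
  ∣D∣*g≡∣Q∣ = ∣det∣*dualGcd≡∣⟪w,w⟫∣ F z-primitive w⊥z
  instance
    ∣D∣*g≢0 : ℕ.NonZero (∣ det w z ∣ ℕ.* dualGcd F w)
    ∣D∣*g≢0 = subst ℕ.NonZero (sym ∣D∣*g≡∣Q∣) (>-nonZero Q>0)
    D≢0 : NonZero (det w z)
    D≢0 = ℕ.m*n≢0⇒m≢0 ∣ det w z ∣
    g≢0 : ℕ.NonZero (dualGcd F w)
    g≢0 = ℕ.m*n≢0⇒n≢0 ∣ det w z ∣
  index : IsIndex w z ∣ det w z ∣
  index = let u , wu≡1 = primitive⇒complement {w} w-primitive in index≡∣det∣ w u z wu≡1
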